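{- For every positive integer $s$ and every positive integer $n$, $$R_{2^s}(n)\equiv \tau_{2^s-1}(n+1)\pmod 2.$$
   Context: For a nonzero integer $k$, $\tau_k$ is defined by $q\prod_{m=1}^{\infty}(1-q^m)^k=\sum_{n=1}^{\infty}\tau_k(n)q^n$. For an integer $t\geq2$, $R_t(n)$ is the number of partitions of $n$ with no part divisible by $t$. -}

module Defs where

open import Data.Nat using (ℕ; zero; suc; _+_; _*_; _∸_; _^_; _≤ᵇ_; _%_; NonZero)
open import Data.Integer as ℤ using (ℤ; +_; -[1+_])
open import Data.List using (List; []; _∷_; length; map; filter; _++_)
open import Data.Bool using (true; false)
open import Data.Nat.Divisibility using (_∣_; _∣?_)
open import Relation.Nullary using (¬_)
open import Relation.Nullary.Decidable using (¬?)
open import Data.List.Relation.Unary.All using (All)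
open import Data.List.Relation.Unary.All.Properties using ()
import Data.List.Relation.Unary.All as All

-- Truncated formal power series over ℤ, represented as coefficient
-- functions ℕ → ℤ (only coefficients of index ≤ N are ever used).

Series : Set
Series = ℕ → ℤ

convSum : Series → Series → ℕ → ℕ → ℤ
convSum f g n zero    = f 0 ℤ.* g n
convSum f g n (suc i) = convSum f g n i ℤ.+ f (suc i) ℤ.* g (n ∸ suc i)

_⊛_ : Series → Series → Series
(f ⊛ g) n = convSum f g n n

one : Series
one zero    = + 1
one (suc _) = + 0

oneMinusQ : ℕ → Series
oneMinusQ m zero = + 1
oneMinusQ m (suc j) with suc j Data.Nat.≟ m
... | Relation.Nullary.yes _ = -[1+ 0 ]
... | Relation.Nullary.no  _ = + 0


-- (1 - q^m)^{-1} = Σ_j q^{m j}   (m ≥ 1)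
geomQ : (m : ℕ) → .{{NonZero m}} → Series
geomQ m j with j % m Data.Nat.≟ 0
... | Relation.Nullary.yes _ = + 1
... | Relation.Nullary.no  _ = + 0

powS : Series → ℕ → Series
powS f zero    = one
powS f (suc e) = f ⊛ powS f e

factorPow : (m : ℕ) → .{{NonZero m}} → ℤ → Series
factorPow m (+ e)      = powS (oneMinusQ m) e
factorPow m -[1+ e ]   = powS (geomQ m) (suc e)

prodUpTo : ℤ → ℕ → Series
prodUpTo k zero    = one
prodUpTo k (suc N) = factorPow (suc N) k ⊛ prodUpTo k N

-- τ_k(n) = coefficient of q^n in q ∏_{m≥1} (1-q^m)^k, for n ≥ 1.
-- The coefficient of q^(n-1) in ∏_{m≥1}(1-q^m)^k only depends on the
-- factors with m ≤ n-1, so truncating the product at m = n is exact.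
τ : ℤ → ℕ → ℤ
τ k zero    = + 0
τ k (suc n) = prodUpTo k (suc n) n

-- Partitions.  A partition of n is a non-increasing list of positive
-- integers summing to n.  partitionsMax m n enumerates (each exactly
-- once) the partitions of n all of whose parts are ≤ m.

-- parts m r fuel : partitions of r with all parts ≤ m (fuel ≥ r suffices)
partsF : ℕ → ℕ → ℕ → List (List ℕ)
partsF m       zero    _          = [] ∷ []
partsF zero    (suc r) _          = []
partsF (suc p) (suc r) zero       = []
partsF (suc p) (suc r) (suc fuel) with suc p ≤ᵇ suc r
... | true  = partsF p (suc r) (suc fuel)
              ++ map (suc p ∷_) (partsF (suc p) (suc r ∸ suc p) fuel)
... | false = partsF p (suc r) (suc fuel)

partitions : ℕ → List (List ℕ)
partitions n = partsF n n n

R : ℕ → ℕ → ℕ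
R t n = length (filter (λ λs → All.all? (λ p → ¬? (t ∣? p)) λs) (partitions n))

-- Modulo 2 the Frobenius gives (1 - q^m)^(2^s - 1) = (1 + q^m)^(2^s) / (1 + q^m)
-- = (1 + q^(2^s m)) / (1 + q^m), hence, with t = 2^s,
--   ∏ₘ (1 - q^m)^(t - 1) ≡ ∏ₘ (1 + q^(t m)) / ∏ₘ (1 + q^m) = ∏_{t ∤ m} 1 / (1 + q^m) ≡ Σₙ R_t(n) q^n.
-- All products are compared in 𝔽₂[[q]] modulo q^(L+1), where the factors with m > L are 1;
-- the parity of R_t(n) satisfies the same recursion as the right-hand side, obtained by
-- splitting off the largest part of a partition.

module Submission where

open import Defs
open import Data.Nat using (ℕ; suc; _∸_; _^_; _≤_)
open import Data.Integer using (ℤ; +_; _-_)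
open import Data.Integer.Divisibility using (_∣_)

open import Algebra.Bundles using (CommutativeMonoid; CommutativeRing)
open import Data.Bool using (Bool; true; false; not; _∧_; _xor_; if_then_else_)
open import Data.Bool.Properties
  using ( xor-assoc; xor-comm; xor-identityʳ; xor-same; xor-annihilates-not; not-distribˡ-xor
        ; not-involutive; ∧-zeroʳ; ∧-assoc; ∧-comm; ∧-distribˡ-xor; ∧-distribʳ-xor
        ; xor-∧-commutativeRing )
open import Data.Integer as ℤ using (-[1+_])
import Data.Integer.Properties as ℤₚ
open import Data.List using (List; []; _∷_; _++_; map; filter; length)
open import Data.List.Properties using (filter-++; length-++)
open import Data.List.Relation.Unary.All as All using (All)
open import Data.Nat as ℕ
  using (zero; _+_; _*_; _<_; _≤′_; ≤′-refl; ≤′-step; _≡ᵇ_; _≤ᵇ_; z≤n; s≤s; NonZero)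
open import Data.Nat.Divisibility as ℕ∣ using (_∣?_; _∣0)
import Data.Nat.Properties as ℕₚ
open import Data.Product using (_,_)
open import Data.Sum using (inj₁; inj₂)
open import Function.Base using (_∘′_)
open import Function.Bundles using (mk⇔)
open import Level using (0ℓ)
open import Relation.Binary.PropositionalEquality
  using (_≡_; refl; sym; trans; cong; cong₂; subst; module ≡-Reasoning)
open import Relation.Nullary.Decidable using (Dec; yes; no; does; ¬?; dec-true; dec-false; does-⇔)
open import Relation.Nullary.Negation using (¬_)

open import Algebra.Properties.CommutativeSemigroup
  (CommutativeRing.+-commutativeSemigroup xor-∧-commutativeRing)
  using () renaming (interchange to xor-interchange)

rangeProduct : ∀ {a} {A : Set a} → (A → A → A) → A → (ℕ → A) → ℕ → A
rangeProduct _∙_ ε F zero    = ε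
rangeProduct _∙_ ε F (suc N) = F (suc N) ∙ rangeProduct _∙_ ε F N

module RangeProduct {c ℓ} (M : CommutativeMonoid c ℓ) where

  open CommutativeMonoid M renaming (refl to ≈-refl; sym to ≈-sym)
  open import Algebra.Properties.CommutativeSemigroup commutativeSemigroup using (interchange)
  open import Relation.Binary.Reasoning.Setoid setoid

  ∏ : (ℕ → Carrier) → ℕ → Carrier
  ∏ = rangeProduct _∙_ ε

  ∏-cong : ∀ {F G} → (∀ m → F (suc m) ≈ G (suc m)) → ∀ N → ∏ F N ≈ ∏ G N
  ∏-cong F≈G zero    = ≈-refl
  ∏-cong F≈G (suc N) = ∙-cong (F≈G N) (∏-cong F≈G N)

  ∏-distrib : ∀ F G N → ∏ (λ m → F m ∙ G m) N ≈ ∏ F N ∙ ∏ G N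
  ∏-distrib F G zero    = ≈-sym (identityˡ ε)
  ∏-distrib F G (suc N) = begin
    (F (suc N) ∙ G (suc N)) ∙ ∏ (λ m → F m ∙ G m) N ≈⟨ ∙-congˡ (∏-distrib F G N) ⟩
    (F (suc N) ∙ G (suc N)) ∙ (∏ F N ∙ ∏ G N)       ≈⟨ interchange _ _ _ _ ⟩
    (F (suc N) ∙ ∏ F N) ∙ (G (suc N) ∙ ∏ G N)       ∎

  ∏-drop : ∀ {F M N} → M ≤ N → (∀ m → M < m → m ≤ N → F m ≈ ε) → ∏ F N ≈ ∏ F M
  ∏-drop {F} {M} M≤N trivial = go (ℕₚ.≤⇒≤′ M≤N) trivial
    where
    go : ∀ {N} → M ≤′ N → (∀ m → M < m → m ≤ N → F m ≈ ε) → ∏ F N ≈ ∏ F M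
    go ≤′-refl          _       = ≈-refl
    go (≤′-step {N} M≤′N) trivial = begin
      F (suc N) ∙ ∏ F N ≈⟨ ∙-cong (trivial (suc N) (s≤s (ℕₚ.≤′⇒≤ M≤′N)) ℕₚ.≤-refl) (go M≤′N (λ m M<m m≤N → trivial m M<m (ℕₚ.m≤n⇒m≤1+n m≤N))) ⟩
      ε ∙ ∏ F M         ≈⟨ identityˡ _ ⟩
      ∏ F M             ∎

-- Power series over 𝔽₂ = (Bool, xor, ∧)

Series₂ : Set
Series₂ = ℕ → Bool

xorSum : (ℕ → Bool) → ℕ → Bool
xorSum a zero    = a 0
xorSum a (suc n) = xorSum a n xor a (suc n)

xorSum-cong : ∀ {a b} n → (∀ i → i ≤ n → a i ≡ b i) → xorSum a n ≡ xorSum b n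
xorSum-cong zero    a≡b = a≡b 0 z≤n
xorSum-cong (suc n) a≡b =
  cong₂ _xor_ (xorSum-cong n (λ i i≤n → a≡b i (ℕₚ.m≤n⇒m≤1+n i≤n))) (a≡b (suc n) ℕₚ.≤-refl)

xorSum-suc : ∀ a n → xorSum a (suc n) ≡ a 0 xor xorSum (λ i → a (suc i)) n
xorSum-suc a zero    = refl
xorSum-suc a (suc n) = trans (cong (_xor a (suc (suc n))) (xorSum-suc a n)) (xor-assoc (a 0) _ _)

xorSum-xor : ∀ a b n → xorSum (λ i → a i xor b i) n ≡ xorSum a n xor xorSum b n
xorSum-xor a b zero    = refl
xorSum-xor a b (suc n) =
  trans (cong (_xor (a (suc n) xor b (suc n))) (xorSum-xor a b n)) (xor-interchange (xorSum a n) (xorSum b n) (a (suc n)) (b (suc n)))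

xorSum-∧ˡ : ∀ c a n → xorSum (λ i → c ∧ a i) n ≡ c ∧ xorSum a n
xorSum-∧ˡ c a zero    = refl
xorSum-∧ˡ c a (suc n) =
  trans (cong (_xor (c ∧ a (suc n))) (xorSum-∧ˡ c a n)) (sym (∧-distribˡ-xor c (xorSum a n) (a (suc n))))

xorSum-∧ʳ : ∀ c a n → xorSum (λ i → a i ∧ c) n ≡ xorSum a n ∧ c
xorSum-∧ʳ c a zero    = refl
xorSum-∧ʳ c a (suc n) =
  trans (cong (_xor (a (suc n) ∧ c)) (xorSum-∧ʳ c a n)) (sym (∧-distribʳ-xor c (xorSum a n) (a (suc n))))

xorSum-reverse : ∀ a n → xorSum a n ≡ xorSum (λ i → a (n ∸ i)) n
xorSum-reverse a zero    = refl
xorSum-reverse a (suc n) = begin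
  xorSum a n xor a (suc n)                         ≡⟨ cong (_xor a (suc n)) (xorSum-reverse a n) ⟩
  xorSum (λ i → a (n ∸ i)) n xor a (suc n)         ≡⟨ xor-comm _ (a (suc n)) ⟩
  a (suc n) xor xorSum (λ i → a (suc n ∸ suc i)) n ≡⟨ xorSum-suc (λ i → a (suc n ∸ i)) n ⟨
  xorSum (λ i → a (suc n ∸ i)) (suc n)             ∎
  where open ≡-Reasoning

≤ᵇ-suc : ∀ m n → (m ≤ᵇ n) ≡ (suc m ≤ᵇ suc n)
≤ᵇ-suc zero    n = refl
≤ᵇ-suc (suc m) n = refl

xorSum-indicator : ∀ m x n → xorSum (λ i → (i ≡ᵇ m) ∧ x i) n ≡ (m ≤ᵇ n) ∧ x m
xorSum-indicator zero    x zero    = refl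
xorSum-indicator zero    x (suc n) =
  trans (xor-identityʳ _) (xorSum-indicator zero x n)
xorSum-indicator (suc m) x zero    = refl
xorSum-indicator (suc m) x (suc n) =
  trans (xorSum-suc (λ i → (i ≡ᵇ suc m) ∧ x i) n)
        (trans (xorSum-indicator m (λ i → x (suc i)) n) (cong (_∧ x (suc m)) (≤ᵇ-suc m n)))

xorSum-triangle : ∀ (F : ℕ → ℕ → Bool) n →
  xorSum (λ i → xorSum (λ j → F j i) i) n ≡ xorSum (λ j → xorSum (λ k → F j (j + k)) (n ∸ j)) n
xorSum-triangle F zero    = refl
xorSum-triangle F (suc n) = begin
  xorSum (λ i → xorSum (λ j → F j i) i) n xor xorSum (λ j → F j (suc n)) (suc n)
    ≡⟨ cong (_xor xorSum (λ j → F j (suc n)) (suc n)) (xorSum-triangle F n) ⟩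
  rows n xor (xorSum (λ j → F j (suc n)) n xor F (suc n) (suc n))
    ≡⟨ xor-assoc (rows n) _ _ ⟨
  (rows n xor xorSum (λ j → F j (suc n)) n) xor F (suc n) (suc n)
    ≡⟨ cong₂ _xor_ (xorSum-xor (row n) (λ j → F j (suc n)) n) (cong (F (suc n)) (ℕₚ.+-identityʳ (suc n))) ⟨
  xorSum (λ j → row n j xor F j (suc n)) n xor F (suc n) (suc n + 0)
    ≡⟨ cong₂ _xor_ (xorSum-cong n extend) (cong (xorSum (λ k → F (suc n) (suc n + k))) (ℕₚ.n∸n≡0 n)) ⟨
  rows (suc n) ∎
  where
  open ≡-Reasoning
  row : ℕ → ℕ → Bool
  row n j = xorSum (λ k → F j (j + k)) (n ∸ j)
  rows : ℕ → Bool
  rows n = xorSum (row n) n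
  extend : ∀ j → j ≤ n → row (suc n) j ≡ row n j xor F j (suc n)
  extend j j≤n = begin
    xorSum (λ k → F j (j + k)) (suc n ∸ j)   ≡⟨ cong (xorSum _) (ℕₚ.+-∸-assoc 1 j≤n) ⟩
    xorSum (λ k → F j (j + k)) (suc (n ∸ j)) ≡⟨ cong (λ k → row n j xor F j k) (trans (ℕₚ.+-suc j (n ∸ j)) (cong suc (ℕₚ.m+[n∸m]≡n j≤n))) ⟩
    row n j xor F j (suc n)                  ∎

infixl 7 _·_
_·_ : Series₂ → Series₂ → Series₂
(f · g) n = xorSum (λ i → f i ∧ g (n ∸ i)) n

𝟙 : Series₂
𝟙 n = n ≡ᵇ 0

·-identityˡ : ∀ f n → (𝟙 · f) n ≡ f n
·-identityˡ f n = xorSum-indicator 0 (λ i → f (n ∸ i)) n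

·-comm : ∀ f g n → (f · g) n ≡ (g · f) n
·-comm f g n = trans (xorSum-reverse _ n) (xorSum-cong n λ i i≤n →
  trans (cong (λ k → f (n ∸ i) ∧ g k) (ℕₚ.m∸[m∸n]≡n i≤n)) (∧-comm (f (n ∸ i)) (g i)))

·-assoc : ∀ f g h n → ((f · g) · h) n ≡ (f · (g · h)) n
·-assoc f g h n = begin
  xorSum (λ i → xorSum (λ j → f j ∧ g (i ∸ j)) i ∧ h (n ∸ i)) n
    ≡⟨ xorSum-cong n (λ i _ → xorSum-∧ʳ (h (n ∸ i)) (λ j → f j ∧ g (i ∸ j)) i) ⟨
  xorSum (λ i → xorSum (λ j → (f j ∧ g (i ∸ j)) ∧ h (n ∸ i)) i) n
    ≡⟨ xorSum-triangle (λ j i → (f j ∧ g (i ∸ j)) ∧ h (n ∸ i)) n ⟩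
  xorSum (λ j → xorSum (λ k → (f j ∧ g (j + k ∸ j)) ∧ h (n ∸ (j + k))) (n ∸ j)) n
    ≡⟨ xorSum-cong n (λ j _ → trans (xorSum-cong (n ∸ j) (λ k _ → reindex j k))
                                    (xorSum-∧ˡ (f j) (λ k → g k ∧ h (n ∸ j ∸ k)) (n ∸ j))) ⟩
  xorSum (λ j → f j ∧ xorSum (λ k → g k ∧ h (n ∸ j ∸ k)) (n ∸ j)) n ∎
  where
  open ≡-Reasoning
  reindex : ∀ j k → (f j ∧ g (j + k ∸ j)) ∧ h (n ∸ (j + k)) ≡ f j ∧ (g k ∧ h (n ∸ j ∸ k))
  reindex j k = trans (∧-assoc (f j) _ _)
    (cong₂ (λ a b → f j ∧ (g a ∧ h b)) (ℕₚ.m+n∸m≡n j k) (sym (ℕₚ.∸-+-assoc n j k)))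

infix 4 _≈[_]_
_≈[_]_ : Series₂ → ℕ → Series₂ → Set
f ≈[ L ] g = ∀ i → i ≤ L → f i ≡ g i

·-cong : ∀ {L f f′ g g′} → f ≈[ L ] f′ → g ≈[ L ] g′ → f · g ≈[ L ] f′ · g′
·-cong f≈f′ g≈g′ n n≤L = xorSum-cong n λ i i≤n →
  cong₂ _∧_ (f≈f′ i (ℕₚ.≤-trans i≤n n≤L)) (g≈g′ (n ∸ i) (ℕₚ.≤-trans (ℕₚ.m∸n≤m n i) n≤L))

·-𝟙-commutativeMonoid : ℕ → CommutativeMonoid 0ℓ 0ℓ
·-𝟙-commutativeMonoid L = record
  { Carrier             = Series₂
  ; _≈_                 = _≈[ L ]_
  ; _∙_                 = _·_
  ; ε                   = 𝟙
  ; isCommutativeMonoid = record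
    { isMonoid = record
      { isSemigroup = record
        { isMagma = record
          { isEquivalence = record
            { refl  = λ _ _ → refl
            ; sym   = λ f≈g i i≤L → sym (f≈g i i≤L)
            ; trans = λ f≈g g≈h i i≤L → trans (f≈g i i≤L) (g≈h i i≤L)
            }
          ; ∙-cong = ·-cong
          }
        ; assoc = λ f g h i _ → ·-assoc f g h i
        }
      ; identity = (λ f i _ → ·-identityˡ f i)
                 , (λ f i _ → trans (·-comm f 𝟙 i) (·-identityˡ f i))
      }
    ; comm = λ f g i _ → ·-comm f g i
    }
  }

∏ : (ℕ → Series₂) → ℕ → Series₂
∏ = rangeProduct _·_ 𝟙

module Truncated (L : ℕ) where
  open CommutativeMonoid (·-𝟙-commutativeMonoid L) public
    using (setoid; ∙-congˡ; ∙-congʳ; assoc; comm; identityˡ; identityʳ)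
    renaming (refl to ≈-refl; sym to ≈-sym; trans to ≈-trans)
  open RangeProduct (·-𝟙-commutativeMonoid L) public
    using (∏-cong; ∏-distrib; ∏-drop)
  open import Relation.Binary.Reasoning.Setoid setoid public

-- 1 + q^m and its inverse Σⱼ q^(m j) (for m ≠ 0).
onePlusQ : ℕ → Series₂
onePlusQ m n = (n ≡ᵇ 0) xor (n ≡ᵇ m)

geometric : ℕ → Series₂
geometric m n = does (m ∣? n)

data Shift (c : ℕ) : ℕ → Set where
  below   : ∀ {n} → n < c → Shift c n
  shifted : ∀ d → Shift c (c + d)

shift : ∀ c n → Shift c n
shift c n with ℕₚ.≤-<-connex c n
... | inj₁ c≤n = subst (Shift c) (ℕₚ.m+[n∸m]≡n c≤n) (shifted (n ∸ c))
... | inj₂ n<c = below n<c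

≤ᵇ-below : ∀ {m n} → n < m → (m ≤ᵇ n) ≡ false
≤ᵇ-below {m} {n} n<m = dec-false (m ℕ.≤? n) (ℕₚ.<⇒≱ n<m)

≤ᵇ-shifted : ∀ m d → (m ≤ᵇ m + d) ≡ true
≤ᵇ-shifted m d = dec-true (m ℕ.≤? m + d) (ℕₚ.m≤m+n m d)

≡ᵇ-below : ∀ {m n} → n < m → (n ≡ᵇ m) ≡ false
≡ᵇ-below {m} {n} n<m = dec-false (n ℕ.≟ m) (ℕₚ.<⇒≢ n<m)

+-≡ᵇ : ∀ c d e → (c + d ≡ᵇ c + e) ≡ (d ≡ᵇ e)
+-≡ᵇ zero    d e = refl
+-≡ᵇ (suc c) d e = +-≡ᵇ c d e

onePlusQ-·ˡ : ∀ m F n → (onePlusQ m · F) n ≡ F n xor ((m ≤ᵇ n) ∧ F (n ∸ m))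
onePlusQ-·ˡ m F n = begin
  xorSum (λ i → ((i ≡ᵇ 0) xor (i ≡ᵇ m)) ∧ F (n ∸ i)) n
    ≡⟨ xorSum-cong n (λ i _ → ∧-distribʳ-xor (F (n ∸ i)) (i ≡ᵇ 0) (i ≡ᵇ m)) ⟩
  xorSum (λ i → ((i ≡ᵇ 0) ∧ F (n ∸ i)) xor ((i ≡ᵇ m) ∧ F (n ∸ i))) n
    ≡⟨ xorSum-xor _ _ n ⟩
  xorSum (λ i → (i ≡ᵇ 0) ∧ F (n ∸ i)) n xor xorSum (λ i → (i ≡ᵇ m) ∧ F (n ∸ i)) n
    ≡⟨ cong₂ _xor_ (xorSum-indicator 0 (λ i → F (n ∸ i)) n) (xorSum-indicator m (λ i → F (n ∸ i)) n) ⟩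
  F n xor ((m ≤ᵇ n) ∧ F (n ∸ m)) ∎
  where open ≡-Reasoning

geometric-zero : ∀ m → geometric m 0 ≡ true
geometric-zero m = dec-true (m ∣? 0) (m ∣0)

geometric-below : ∀ {m n} → n < m → geometric m n ≡ 𝟙 n
geometric-below {m} {zero}  _   = dec-true (m ∣? 0) (m ∣0)
geometric-below {m} {suc n} n<m = dec-false (m ∣? suc n) (λ m∣n → ℕₚ.<⇒≱ n<m (ℕ∣.∣⇒≤ m∣n))

𝟙-shifted : ∀ m d .{{_ : NonZero m}} → 𝟙 (m + d) ≡ false
𝟙-shifted (suc m) d = refl

geometric-shifted : ∀ m d → geometric m (m + d) ≡ geometric m d
geometric-shifted m d = does-⇔ (mk⇔ (λ m∣m+d → ℕ∣.∣m+n∣m⇒∣n m∣m+d ℕ∣.∣-refl) (ℕ∣.∣m∣n⇒∣m+n ℕ∣.∣-refl))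
  (m ∣? (m + d)) (m ∣? d)

onePlusQ-·-geometric : ∀ {L} m .{{_ : NonZero m}} → onePlusQ m · geometric m ≈[ L ] 𝟙
onePlusQ-·-geometric m n _ with shift m n
... | below n<m = begin
  (onePlusQ m · geometric m) n                ≡⟨ onePlusQ-·ˡ m (geometric m) n ⟩
  geometric m n xor ((m ≤ᵇ n) ∧ geometric m (n ∸ m)) ≡⟨ cong₂ (λ a b → a xor (b ∧ geometric m (n ∸ m))) (geometric-below n<m) (≤ᵇ-below n<m) ⟩
  𝟙 n xor false                               ≡⟨ xor-identityʳ (𝟙 n) ⟩
  𝟙 n                                         ∎
  where open ≡-Reasoning
... | shifted d = begin
  (onePlusQ m · geometric m) (m + d)                               ≡⟨ onePlusQ-·ˡ m (geometric m) (m + d) ⟩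
  geometric m (m + d) xor ((m ≤ᵇ m + d) ∧ geometric m (m + d ∸ m)) ≡⟨ cong₂ (λ a b → geometric m (m + d) xor (a ∧ geometric m b)) (≤ᵇ-shifted m d) (ℕₚ.m+n∸m≡n m d) ⟩
  geometric m (m + d) xor geometric m d                            ≡⟨ cong (_xor geometric m d) (geometric-shifted m d) ⟩
  geometric m d xor geometric m d                                  ≡⟨ xor-same (geometric m d) ⟩
  false                                                            ≡⟨ 𝟙-shifted m d ⟨
  𝟙 (m + d)                                                        ∎
  where open ≡-Reasoning

onePlusQ-below : ∀ {m n} → n < m → onePlusQ m n ≡ 𝟙 n
onePlusQ-below {m} {n} n<m = trans (cong (𝟙 n xor_) (≡ᵇ-below n<m)) (xor-identityʳ (𝟙 n))

onePlusQ-shifted : ∀ c d e .{{_ : NonZero c}} → onePlusQ (c + e) (c + d) ≡ (d ≡ᵇ e)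
onePlusQ-shifted c d e = cong₂ _xor_ (𝟙-shifted c d) (+-≡ᵇ c d e)

onePlusQ-≈𝟙 : ∀ {L m} → L < m → onePlusQ m ≈[ L ] 𝟙
onePlusQ-≈𝟙 L<m i i≤L = onePlusQ-below (ℕₚ.≤-<-trans i≤L L<m)

onePlusQ-square : ∀ {L} c .{{_ : NonZero c}} → onePlusQ c · onePlusQ c ≈[ L ] onePlusQ (c + c)
onePlusQ-square c n _ with shift c n
... | below n<c = begin
  (onePlusQ c · onePlusQ c) n                                ≡⟨ onePlusQ-·ˡ c (onePlusQ c) n ⟩
  onePlusQ c n xor ((c ≤ᵇ n) ∧ onePlusQ c (n ∸ c))           ≡⟨ cong (onePlusQ c n xor_) (cong (_∧ onePlusQ c (n ∸ c)) (≤ᵇ-below n<c)) ⟩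
  onePlusQ c n xor false                                     ≡⟨ xor-identityʳ (onePlusQ c n) ⟩
  onePlusQ c n                                               ≡⟨ onePlusQ-below n<c ⟩
  𝟙 n                                                        ≡⟨ onePlusQ-below (ℕₚ.<-≤-trans n<c (ℕₚ.m≤m+n c c)) ⟨
  onePlusQ (c + c) n                                         ∎
  where open ≡-Reasoning
... | shifted d = begin
  (onePlusQ c · onePlusQ c) (c + d)                          ≡⟨ onePlusQ-·ˡ c (onePlusQ c) (c + d) ⟩
  onePlusQ c (c + d) xor ((c ≤ᵇ c + d) ∧ onePlusQ c (c + d ∸ c)) ≡⟨ cong₂ (λ a b → onePlusQ c (c + d) xor (a ∧ onePlusQ c b)) (≤ᵇ-shifted c d) (ℕₚ.m+n∸m≡n c d) ⟩
  onePlusQ c (c + d) xor onePlusQ c d                        ≡⟨ cong (λ e → onePlusQ e (c + d) xor onePlusQ c d) (ℕₚ.+-identityʳ c) ⟨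
  onePlusQ (c + 0) (c + d) xor onePlusQ c d                  ≡⟨ cong (_xor onePlusQ c d) (onePlusQ-shifted c d 0) ⟩
  (d ≡ᵇ 0) xor ((d ≡ᵇ 0) xor (d ≡ᵇ c))                      ≡⟨ xor-assoc (d ≡ᵇ 0) (d ≡ᵇ 0) (d ≡ᵇ c) ⟨
  ((d ≡ᵇ 0) xor (d ≡ᵇ 0)) xor (d ≡ᵇ c)                      ≡⟨ cong (_xor (d ≡ᵇ c)) (xor-same (d ≡ᵇ 0)) ⟩
  d ≡ᵇ c                                                     ≡⟨ onePlusQ-shifted c d c ⟨
  onePlusQ (c + c) (c + d)                                   ∎
  where open ≡-Reasoning

infixr 8 _^ₛ_
_^ₛ_ : Series₂ → ℕ → Series₂
f ^ₛ zero  = 𝟙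
f ^ₛ suc e = f · f ^ₛ e

^ₛ-+ : ∀ {L} f a b → f ^ₛ (a + b) ≈[ L ] f ^ₛ a · f ^ₛ b
^ₛ-+ {L} f zero    b = ≈-sym (identityˡ (f ^ₛ b)) where open Truncated L
^ₛ-+ {L} f (suc a) b = ≈-trans (∙-congˡ (^ₛ-+ f a b)) (≈-sym (assoc f (f ^ₛ a) (f ^ₛ b)))
  where open Truncated L

^ₛ-cong : ∀ {L f g} → f ≈[ L ] g → ∀ e → f ^ₛ e ≈[ L ] g ^ₛ e
^ₛ-cong f≈g zero    _ _ = refl
^ₛ-cong f≈g (suc e)     = ·-cong f≈g (^ₛ-cong f≈g e)

onePlusQ-^-2^ : ∀ {L} s c .{{_ : NonZero c}} → onePlusQ c ^ₛ (2 ^ s) ≈[ L ] onePlusQ (2 ^ s * c)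
onePlusQ-^-2^ {L} zero c = begin
  onePlusQ c · 𝟙    ≈⟨ identityʳ (onePlusQ c) ⟩
  onePlusQ c        ≡⟨ cong onePlusQ (ℕₚ.+-identityʳ c) ⟨
  onePlusQ (1 * c)  ∎
  where open Truncated L
onePlusQ-^-2^ {L} (suc s) c = begin
  onePlusQ c ^ₛ (e + (e + 0))         ≡⟨ cong (λ k → onePlusQ c ^ₛ (e + k)) (ℕₚ.+-identityʳ e) ⟩
  onePlusQ c ^ₛ (e + e)               ≈⟨ ^ₛ-+ (onePlusQ c) e e ⟩
  onePlusQ c ^ₛ e · onePlusQ c ^ₛ e   ≈⟨ ·-cong (onePlusQ-^-2^ s c) (onePlusQ-^-2^ s c) ⟩
  onePlusQ (e * c) · onePlusQ (e * c) ≈⟨ onePlusQ-square (e * c) ⟩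
  onePlusQ (e * c + e * c)            ≡⟨ cong onePlusQ (ℕₚ.*-distribʳ-+ c e e) ⟨
  onePlusQ ((e + e) * c)              ≡⟨ cong (λ k → onePlusQ ((e + k) * c)) (ℕₚ.+-identityʳ e) ⟨
  onePlusQ (2 ^ suc s * c)            ∎
  where
  open Truncated L
  e = 2 ^ s
  instance
    _ = ℕₚ.m^n≢0 2 s
    _ = ℕₚ.m*n≢0 e c

odd : ℕ → Bool
odd zero    = false
odd (suc n) = not (odd n)

odd-+ : ∀ m n → odd (m + n) ≡ odd m xor odd n
odd-+ zero    n = refl
odd-+ (suc m) n = trans (cong not (odd-+ m n)) (not-distribˡ-xor (odd m) (odd n))

odd-* : ∀ m n → odd (m * n) ≡ odd m ∧ odd n
odd-* zero    n = refl
odd-* (suc m) n = trans (odd-+ n (m * n)) (trans (cong (odd n xor_) (odd-* m n)) (absorb (odd m) (odd n)))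
  where
  absorb : ∀ a b → b xor (a ∧ b) ≡ not a ∧ b
  absorb true  b = xor-same b
  absorb false b = xor-identityʳ b

odd⇒2∣ : ∀ n → odd n ≡ false → 2 ℕ∣.∣ n
odd⇒2∣ zero          _    = 2 ∣0
odd⇒2∣ (suc zero)    ()
odd⇒2∣ (suc (suc n)) even = ℕ∣.∣m∣n⇒∣m+n (ℕ∣.∣-refl {2}) (odd⇒2∣ n (trans (sym (not-involutive (odd n))) even))

oddℤ : ℤ → Bool
oddℤ a = odd ℤ.∣ a ∣

odd-⊖ : ∀ m n → oddℤ (m ℤ.⊖ n) ≡ odd m xor odd n
odd-⊖ zero    zero    = refl
odd-⊖ zero    (suc n) = refl
odd-⊖ (suc m) zero    = sym (xor-identityʳ _)
odd-⊖ (suc m) (suc n) = begin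
  oddℤ (suc m ℤ.⊖ suc n)    ≡⟨ cong oddℤ (ℤₚ.[1+m]⊖[1+n]≡m⊖n m n) ⟩
  oddℤ (m ℤ.⊖ n)            ≡⟨ odd-⊖ m n ⟩
  odd m xor odd n           ≡⟨ xor-annihilates-not (odd m) (odd n) ⟨
  odd (suc m) xor odd (suc n) ∎
  where open ≡-Reasoning

oddℤ-+ : ∀ a b → oddℤ (a ℤ.+ b) ≡ oddℤ a xor oddℤ b
oddℤ-+ (+ m)    (+ n)    = odd-+ m n
oddℤ-+ (+ m)    -[1+ n ] = odd-⊖ m (suc n)
oddℤ-+ -[1+ m ] (+ n)    = trans (odd-⊖ n (suc m)) (xor-comm (odd n) _)
oddℤ-+ -[1+ m ] -[1+ n ] =
  trans (not-involutive _) (trans (odd-+ m n) (sym (xor-annihilates-not (odd m) (odd n))))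

oddℤ-* : ∀ a b → oddℤ (a ℤ.* b) ≡ oddℤ a ∧ oddℤ b
oddℤ-* a b = trans (cong odd (ℤₚ.abs-* a b)) (odd-* ℤ.∣ a ∣ ℤ.∣ b ∣)

oddℤ-neg : ∀ a → oddℤ (ℤ.- a) ≡ oddℤ a
oddℤ-neg a = cong odd (ℤₚ.∣-i∣≡∣i∣ a)

mod2 : Series → Series₂
mod2 f n = oddℤ (f n)

mod2-⊛ : ∀ {L} f g → mod2 (f ⊛ g) ≈[ L ] mod2 f · mod2 g
mod2-⊛ f g n _ = go n
  where
  go : ∀ i → oddℤ (convSum f g n i) ≡ xorSum (λ j → mod2 f j ∧ mod2 g (n ∸ j)) i
  go zero    = oddℤ-* (f 0) (g n)
  go (suc i) = trans (oddℤ-+ (convSum f g n i) _) (cong₂ _xor_ (go i) (oddℤ-* (f (suc i)) _))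

mod2-one : ∀ {L} → mod2 one ≈[ L ] 𝟙
mod2-one zero    _ = refl
mod2-one (suc n) _ = refl

mod2-oneMinusQ : ∀ {L} m .{{_ : NonZero m}} → mod2 (oneMinusQ m) ≈[ L ] onePlusQ m
mod2-oneMinusQ (suc m) zero    _ = refl
mod2-oneMinusQ (suc m) (suc j) _ with suc j ℕ.≟ suc m
... | yes j≡m = sym (dec-true (suc j ℕ.≟ suc m) j≡m)
... | no  j≢m = sym (dec-false (suc j ℕ.≟ suc m) j≢m)

mod2-powS : ∀ {L} f e → mod2 (powS f e) ≈[ L ] mod2 f ^ₛ e
mod2-powS f zero    = mod2-one
mod2-powS f (suc e) i i≤L =
  trans (mod2-⊛ f (powS f e) i i≤L) (·-cong (λ _ _ → refl) (mod2-powS f e) i i≤L)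

mod2-prodUpTo : ∀ {L} e N → mod2 (prodUpTo (+ e) N) ≈[ L ] ∏ (λ m → onePlusQ m ^ₛ e) N
mod2-prodUpTo e zero        = mod2-one
mod2-prodUpTo {L} e (suc N) = begin
  mod2 (powS (oneMinusQ (suc N)) e ⊛ prodUpTo (+ e) N)   ≈⟨ mod2-⊛ _ _ ⟩
  mod2 (powS (oneMinusQ (suc N)) e) · mod2 (prodUpTo (+ e) N)
    ≈⟨ ·-cong (≈-trans (mod2-powS _ e) (^ₛ-cong (mod2-oneMinusQ (suc N)) e)) (mod2-prodUpTo e N) ⟩
  onePlusQ (suc N) ^ₛ e · ∏ (λ m → onePlusQ m ^ₛ e) N   ∎
  where open Truncated L

-- Partitions with no part divisible by t

xor-transpose : ∀ {a b c} → a ≡ b xor c → b ≡ a xor c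
xor-transpose {b = b} {c} refl =
  sym (trans (xor-assoc b c c) (trans (cong (b xor_) (xor-same c)) (xor-identityʳ b)))

-- With b = does (t ∣? m) this is the recurrence for partitions whose largest part is m.
factor-recurrence : ∀ b m .{{_ : NonZero m}} F n →
  ((if b then 𝟙 else geometric m) · F) n ≡
  F n xor (not b ∧ ((m ≤ᵇ n) ∧ ((if b then 𝟙 else geometric m) · F) (n ∸ m)))
factor-recurrence true  m F n = trans (·-identityˡ F n) (sym (xor-identityʳ (F n)))
factor-recurrence false m F n = xor-transpose (begin
  F n                                                  ≡⟨ ·-identityˡ F n ⟨
  (𝟙 · F) n                                            ≡⟨ Truncated.∙-congʳ n {F} (onePlusQ-·-geometric m) n ℕₚ.≤-refl ⟨
  (onePlusQ m · geometric m · F) n                     ≡⟨ ·-assoc (onePlusQ m) (geometric m) F n ⟩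
  (onePlusQ m · (geometric m · F)) n                   ≡⟨ onePlusQ-·ˡ m (geometric m · F) n ⟩
  (geometric m · F) n xor ((m ≤ᵇ n) ∧ (geometric m · F) (n ∸ m)) ∎)
  where open ≡-Reasoning

module _ (t : ℕ) where

  nonMultipleFactor : ℕ → Series₂
  nonMultipleFactor m = if does (t ∣? m) then 𝟙 else geometric m

  -- Σₙ R_t(n) q^n = ∏_{t ∤ m} 1 / (1 - q^m), reduced mod 2 and truncated to the factors m ≤ N.
  regularProduct : ℕ → Series₂
  regularProduct = ∏ nonMultipleFactor

  regularProduct-zero : ∀ p → regularProduct p 0 ≡ true
  regularProduct-zero zero    = refl
  regularProduct-zero (suc p) = cong₂ _∧_ (factor-zero (does (t ∣? suc p))) (regularProduct-zero p)
    where
    factor-zero : ∀ b → (if b then 𝟙 else geometric (suc p)) 0 ≡ true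
    factor-zero true  = refl
    factor-zero false = geometric-zero (suc p)

  regularProduct-suc : ∀ p n → regularProduct (suc p) n ≡
    regularProduct p n xor (not (does (t ∣? suc p)) ∧ ((suc p ≤ᵇ n) ∧ regularProduct (suc p) (n ∸ suc p)))
  regularProduct-suc p = factor-recurrence (does (t ∣? suc p)) (suc p) (regularProduct p)

  nonMultipleFactor-≈𝟙 : ∀ {L m} → L < m → nonMultipleFactor m ≈[ L ] 𝟙
  nonMultipleFactor-≈𝟙 {L} {m} L<m = go (does (t ∣? m))
    where
    go : ∀ b → (if b then 𝟙 else geometric m) ≈[ L ] 𝟙
    go true  = λ _ _ → refl
    go false = λ i i≤L → geometric-below (ℕₚ.≤-<-trans i≤L L<m)

  noMultiplePart? : (λs : List ℕ) → Dec (All (λ p → ¬ (t ℕ∣.∣ p)) λs)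
  noMultiplePart? λs = All.all? (λ p → ¬? (t ∣? p)) λs

  oddCount : List (List ℕ) → Bool
  oddCount xs = odd (length (filter noMultiplePart? xs))

  oddCount-∷ : ∀ xs λs → oddCount (λs ∷ xs) ≡ does (noMultiplePart? λs) xor oddCount xs
  oddCount-∷ xs λs with does (noMultiplePart? λs)
  ... | true  = refl
  ... | false = refl

  oddCount-++ : ∀ xs ys → oddCount (xs ++ ys) ≡ oddCount xs xor oddCount ys
  oddCount-++ xs ys = begin
    odd (length (filter noMultiplePart? (xs ++ ys)))          ≡⟨ cong (odd ∘′ length) (filter-++ noMultiplePart? xs ys) ⟩
    odd (length (filter noMultiplePart? xs ++ filter noMultiplePart? ys))
                                                              ≡⟨ cong odd (length-++ (filter noMultiplePart? xs)) ⟩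
    odd (length (filter noMultiplePart? xs) + length (filter noMultiplePart? ys))
                                                              ≡⟨ odd-+ (length (filter noMultiplePart? xs)) _ ⟩
    oddCount xs xor oddCount ys                               ∎
    where open ≡-Reasoning

  oddCount-map-∷ : ∀ p xs → oddCount (map (p ∷_) xs) ≡ not (does (t ∣? p)) ∧ oddCount xs
  oddCount-map-∷ p []        = sym (∧-zeroʳ _)
  oddCount-map-∷ p (λs ∷ xs) = begin
    oddCount (map (p ∷_) (λs ∷ xs))                  ≡⟨ oddCount-∷ (map (p ∷_) xs) (p ∷ λs) ⟩
    (ok ∧ does (noMultiplePart? λs)) xor oddCount (map (p ∷_) xs)
                                                     ≡⟨ cong ((ok ∧ does (noMultiplePart? λs)) xor_) (oddCount-map-∷ p xs) ⟩
    (ok ∧ does (noMultiplePart? λs)) xor (ok ∧ oddCount xs)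
                                                     ≡⟨ ∧-distribˡ-xor ok (does (noMultiplePart? λs)) (oddCount xs) ⟨
    ok ∧ (does (noMultiplePart? λs) xor oddCount xs) ≡⟨ cong (ok ∧_) (oddCount-∷ xs λs) ⟨
    ok ∧ oddCount (λs ∷ xs)                          ∎
    where
    open ≡-Reasoning
    ok = not (does (t ∣? p))

  oddCount-partsF : ∀ fuel p r → r ≤ fuel → oddCount (partsF p r fuel) ≡ regularProduct p r
  oddCount-partsF fuel    p       zero    _   = sym (regularProduct-zero p)
  oddCount-partsF fuel    zero    (suc r) _   = refl
  oddCount-partsF (suc f) (suc p) (suc r) r≤f with suc p ≤ᵇ suc r in fits
  ... | true  = begin
    oddCount (partsF p (suc r) (suc f) ++ map (suc p ∷_) (partsF (suc p) (r ∸ p) f))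
      ≡⟨ oddCount-++ (partsF p (suc r) (suc f)) (map (suc p ∷_) (partsF (suc p) (r ∸ p) f)) ⟩
    oddCount (partsF p (suc r) (suc f)) xor oddCount (map (suc p ∷_) (partsF (suc p) (r ∸ p) f))
      ≡⟨ cong₂ _xor_ (oddCount-partsF (suc f) p (suc r) r≤f) (oddCount-map-∷ (suc p) (partsF (suc p) (r ∸ p) f)) ⟩
    regularProduct p (suc r) xor (ok ∧ oddCount (partsF (suc p) (r ∸ p) f))
      ≡⟨ cong (λ c → regularProduct p (suc r) xor (ok ∧ c)) (oddCount-partsF f (suc p) (r ∸ p) r∸p≤f) ⟩
    regularProduct p (suc r) xor (ok ∧ regularProduct (suc p) (r ∸ p))
      ≡⟨ cong (λ b → regularProduct p (suc r) xor (ok ∧ (b ∧ regularProduct (suc p) (r ∸ p)))) fits ⟨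
    regularProduct p (suc r) xor (ok ∧ ((suc p ≤ᵇ suc r) ∧ regularProduct (suc p) (r ∸ p)))
      ≡⟨ regularProduct-suc p (suc r) ⟨
    regularProduct (suc p) (suc r) ∎
    where
    open ≡-Reasoning
    ok = not (does (t ∣? suc p))
    r∸p≤f : r ∸ p ≤ f
    r∸p≤f = ℕₚ.≤-trans (ℕₚ.m∸n≤m r p) (ℕₚ.≤-pred r≤f)
  ... | false = begin
    oddCount (partsF p (suc r) (suc f))
      ≡⟨ oddCount-partsF (suc f) p (suc r) r≤f ⟩
    regularProduct p (suc r)
      ≡⟨ xor-identityʳ _ ⟨
    regularProduct p (suc r) xor false
      ≡⟨ cong (regularProduct p (suc r) xor_) (∧-zeroʳ ok) ⟨
    regularProduct p (suc r) xor (ok ∧ false)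
      ≡⟨ cong (λ b → regularProduct p (suc r) xor (ok ∧ (b ∧ regularProduct (suc p) (r ∸ p)))) fits ⟨
    regularProduct p (suc r) xor (ok ∧ ((suc p ≤ᵇ suc r) ∧ regularProduct (suc p) (r ∸ p)))
      ≡⟨ regularProduct-suc p (suc r) ⟨
    regularProduct (suc p) (suc r) ∎
    where
    open ≡-Reasoning
    ok = not (does (t ∣? suc p))

  odd-R : ∀ n → odd (R t n) ≡ regularProduct n n
  odd-R n = oddCount-partsF n n n ℕₚ.≤-refl

-- The congruence of generating functions

module _ (t : ℕ) .{{_ : NonZero t}} where

  multipleFactor : ℕ → Series₂
  multipleFactor m = if does (t ∣? m) then onePlusQ m else 𝟙

  multipleProduct : ℕ → Series₂
  multipleProduct = ∏ multipleFactor

  regularProduct-·-∏onePlusQ : ∀ {L} N → regularProduct t N · ∏ onePlusQ N ≈[ L ] multipleProduct N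
  regularProduct-·-∏onePlusQ {L} N = begin
    regularProduct t N · ∏ onePlusQ N              ≈⟨ ∏-distrib (nonMultipleFactor t) onePlusQ N ⟨
    ∏ (λ m → nonMultipleFactor t m · onePlusQ m) N ≈⟨ ∏-cong (λ m → factor (does (t ∣? suc m)) (suc m)) N ⟩
    multipleProduct N                              ∎
    where
    open Truncated L
    factor : ∀ b m .{{_ : NonZero m}} →
      (if b then 𝟙 else geometric m) · onePlusQ m ≈[ L ] (if b then onePlusQ m else 𝟙)
    factor true  m = identityˡ (onePlusQ m)
    factor false m = ≈-trans (comm (geometric m) (onePlusQ m)) (onePlusQ-·-geometric m)

  multipleFactor-≈𝟙 : ∀ {L m} → L < m → multipleFactor m ≈[ L ] 𝟙
  multipleFactor-≈𝟙 {L} {m} L<m = go (does (t ∣? m))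
    where
    go : ∀ b → (if b then onePlusQ m else 𝟙) ≈[ L ] 𝟙
    go true  = onePlusQ-≈𝟙 L<m
    go false = λ _ _ → refl

  multipleProduct-truncate : ∀ {L N M} → L ≤ N → N ≤ M → multipleProduct M ≈[ L ] multipleProduct N
  multipleProduct-truncate {L} L≤N N≤M =
    Truncated.∏-drop L N≤M (λ m N<m _ → multipleFactor-≈𝟙 (ℕₚ.≤-<-trans L≤N N<m))

  no-multiple-between : ∀ K {m} → K * t < m → m < K * t + t → ¬ (t ℕ∣.∣ m)
  no-multiple-between K {m} Kt<m m<Kt+t t∣m = ℕₚ.<⇒≱ d<t (ℕ∣.∣⇒≤ {{ℕ.>-nonZero (ℕₚ.m<n⇒0<n∸m Kt<m)}} t∣d)
    where
    d = m ∸ K * t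
    split : K * t + d ≡ m
    split = ℕₚ.m+[n∸m]≡n (ℕₚ.<⇒≤ Kt<m)
    t∣d : t ℕ∣.∣ d
    t∣d = ℕ∣.∣m+n∣m⇒∣n (subst (t ℕ∣.∣_) (sym split) t∣m) (ℕ∣.n∣m*n K)
    d<t : d < t
    d<t = ℕₚ.+-cancelˡ-< (K * t) d t (subst (_< K * t + t) (sym split) m<Kt+t)

  multipleFactor-nonMultiple : ∀ {L m} → ¬ (t ℕ∣.∣ m) → multipleFactor m ≈[ L ] 𝟙
  multipleFactor-nonMultiple {m = m} t∤m i _ =
    cong (λ b → (if b then onePlusQ m else 𝟙) i) (dec-false (t ∣? m) t∤m)

  multipleFactor-multiple : ∀ {L} k → multipleFactor (k * t) ≈[ L ] onePlusQ (t * k)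
  multipleFactor-multiple k i _ =
    trans (cong (λ b → (if b then onePlusQ (k * t) else 𝟙) i) (dec-true (t ∣? k * t) (ℕ∣.n∣m*n k)))
          (cong (λ m → onePlusQ m i) (ℕₚ.*-comm k t))

  multipleProduct-multiples : ∀ {L} K → multipleProduct (K * t) ≈[ L ] ∏ (λ k → onePlusQ (t * k)) K
  multipleProduct-multiples     zero    = λ _ _ → refl
  multipleProduct-multiples {L} (suc K) = begin
    multipleProduct (suc K * t)                                      ≡⟨ cong multipleProduct top ⟩
    multipleFactor (suc (K * t + t′)) · multipleProduct (K * t + t′) ≈⟨ ·-cong top-factor (∏-drop (ℕₚ.m≤m+n (K * t) t′) between) ⟩
    onePlusQ (t * suc K) · multipleProduct (K * t)                   ≈⟨ ∙-congˡ (multipleProduct-multiples K) ⟩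
    onePlusQ (t * suc K) · ∏ (λ k → onePlusQ (t * k)) K              ∎
    where
    open Truncated L
    t′ = t ∸ 1
    suc-t′ : suc t′ ≡ t
    suc-t′ = ℕₚ.m+[n∸m]≡n (ℕ.>-nonZero⁻¹ t)
    top : suc K * t ≡ suc (K * t + t′)
    top = trans (ℕₚ.+-comm t (K * t)) (trans (cong (λ x → K * t + x) (sym suc-t′)) (ℕₚ.+-suc (K * t) t′))
    top-factor : multipleFactor (suc (K * t + t′)) ≈[ L ] onePlusQ (t * suc K)
    top-factor = subst (λ m → multipleFactor m ≈[ L ] onePlusQ (t * suc K)) top (multipleFactor-multiple (suc K))
    between : ∀ m → K * t < m → m ≤ K * t + t′ → multipleFactor m ≈[ L ] 𝟙
    between m Kt<m m≤ = multipleFactor-nonMultiple (no-multiple-between K Kt<m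
      (ℕₚ.≤-<-trans m≤ (ℕₚ.+-monoʳ-< (K * t) (subst (t′ <_) suc-t′ (ℕₚ.n<1+n t′)))))

∏onePlusQ-·-∏geometric : ∀ {L} N → ∏ onePlusQ N · ∏ geometric N ≈[ L ] 𝟙
∏onePlusQ-·-∏geometric {L} N = ≈-trans (≈-sym (∏-distrib onePlusQ geometric N))
  (∏-drop {N = N} z≤n (λ m 0<m _ → onePlusQ-·-geometric m {{ℕ.>-nonZero 0<m}}))
  where open Truncated L

∏power-·-∏onePlusQ : ∀ {L} s N →
  ∏ (λ m → onePlusQ m ^ₛ (2 ^ s ∸ 1)) N · ∏ onePlusQ N ≈[ L ] ∏ (λ m → onePlusQ (2 ^ s * m)) N
∏power-·-∏onePlusQ {L} s N = ≈-trans (≈-sym (∏-distrib _ onePlusQ N)) (∏-cong factor N)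
  where
  open Truncated L
  factor : ∀ m → onePlusQ (suc m) ^ₛ (2 ^ s ∸ 1) · onePlusQ (suc m) ≈[ L ] onePlusQ (2 ^ s * suc m)
  factor m = begin
    onePlusQ (suc m) ^ₛ (2 ^ s ∸ 1) · onePlusQ (suc m) ≈⟨ comm _ (onePlusQ (suc m)) ⟩
    onePlusQ (suc m) ^ₛ suc (2 ^ s ∸ 1)                ≡⟨ cong (onePlusQ (suc m) ^ₛ_) (ℕₚ.m+[n∸m]≡n (ℕₚ.m^n>0 2 s)) ⟩
    onePlusQ (suc m) ^ₛ (2 ^ s)                        ≈⟨ onePlusQ-^-2^ s (suc m) ⟩
    onePlusQ (2 ^ s * suc m)                           ∎

product-congruence : ∀ s {L} N → L ≤ N →
  ∏ (λ m → onePlusQ m ^ₛ (2 ^ s ∸ 1)) N ≈[ L ] regularProduct (2 ^ s) N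
product-congruence s {L} N L≤N = begin
  A                               ≈⟨ identityʳ A ⟨
  A · 𝟙                           ≈⟨ ∙-congˡ {A} (∏onePlusQ-·-∏geometric N) ⟨
  A · (U · V)                     ≈⟨ assoc A U V ⟨
  A · U · V                       ≈⟨ ∙-congʳ {V} (∏power-·-∏onePlusQ s N) ⟩
  W · V                           ≈⟨ ∙-congʳ {V} (multipleProduct-multiples t N) ⟨
  multipleProduct t (N * t) · V   ≈⟨ ∙-congʳ {V} (multipleProduct-truncate t L≤N (ℕₚ.m≤m*n N t)) ⟩
  multipleProduct t N · V         ≈⟨ ∙-congʳ {V} (regularProduct-·-∏onePlusQ t N) ⟨
  C · U · V                       ≈⟨ assoc C U V ⟩
  C · (U · V)                     ≈⟨ ∙-congˡ {C} (∏onePlusQ-·-∏geometric N) ⟩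
  C · 𝟙                           ≈⟨ identityʳ C ⟩
  C                               ∎
  where
  open Truncated L
  t = 2 ^ s
  instance _ = ℕₚ.m^n≢0 2 s
  A = ∏ (λ m → onePlusQ m ^ₛ (t ∸ 1)) N
  U = ∏ onePlusQ N
  V = ∏ geometric N
  W = ∏ (λ m → onePlusQ (t * m)) N
  C = regularProduct t N

odd-τ : ∀ s n → oddℤ (τ (+ (2 ^ s ∸ 1)) (suc n)) ≡ regularProduct (2 ^ s) n n
odd-τ s n = begin
  mod2 (prodUpTo (+ (2 ^ s ∸ 1)) (suc n)) n        ≡⟨ mod2-prodUpTo (2 ^ s ∸ 1) (suc n) n ℕₚ.≤-refl ⟩
  ∏ (λ m → onePlusQ m ^ₛ (2 ^ s ∸ 1)) (suc n) n    ≡⟨ product-congruence s (suc n) (ℕₚ.n≤1+n n) n ℕₚ.≤-refl ⟩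
  regularProduct (2 ^ s) (suc n) n                 ≡⟨ ∏-drop (ℕₚ.n≤1+n n) last n ℕₚ.≤-refl ⟩
  regularProduct (2 ^ s) n n                       ∎
  where
  open ≡-Reasoning
  open Truncated n using (∏-drop)
  last : ∀ m → n < m → m ≤ suc n → nonMultipleFactor (2 ^ s) m ≈[ n ] 𝟙
  last m n<m _ = nonMultipleFactor-≈𝟙 (2 ^ s) n<m

-- The congruence holds for all s and n.
mainTheorem8 : (s n : ℕ) → 1 ≤ s → 1 ≤ n →
    (+ 2) ∣ ((+ R (2 ^ s) n) - τ (+ (2 ^ s ∸ 1)) (suc n))
mainTheorem8 s n _ _ = odd⇒2∣ _ (begin
  oddℤ (+ R t n ℤ.+ ℤ.- τ k (suc n))            ≡⟨ oddℤ-+ (+ R t n) (ℤ.- τ k (suc n)) ⟩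
  odd (R t n) xor oddℤ (ℤ.- τ k (suc n))        ≡⟨ cong (odd (R t n) xor_) (oddℤ-neg (τ k (suc n))) ⟩
  odd (R t n) xor oddℤ (τ k (suc n))            ≡⟨ cong₂ _xor_ (odd-R t n) (odd-τ s n) ⟩
  regularProduct t n n xor regularProduct t n n ≡⟨ xor-same (regularProduct t n n) ⟩
  false                                         ∎)
  where
  open ≡-Reasoning
  t = 2 ^ s
  k = + (2 ^ s ∸ 1)
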